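{- Let $H$ be a graph (loops allowed) and let $(G,L)$ be an instance of $\textsc{LHom}(H^*)$ which is consistent. Define $L'(x):=\{u\in V(H):\{u',u''\}\cap L(x)\ne\emptyset\}$ for $x\in V(G)$. Then there is a list homomorphism $(G,L)\to H^*$ if and only if there is a list homomorphism $(G,L')\to H$.
   Context: A list homomorphism $(G,L)\to H$ is an edge-preserving map $h:V(G)\to V(H)$ with $h(x)\in L(x)$ for all $x$. $H^*$ has bipartition classes $X^*=\{v':v\in V(H)\}$ and $Y^*=\{v'':v\in V(H)\}$, with $u'v''\in E(H^*)$ iff $uv\in E(H)$ (including $u=v$ for loops). An instance $(G,L)$ of $\textsc{LHom}(H^*)$ (lists $L(x)\subseteq V(H^*)$) is consistent if: $G$ is connected and bipartite with bipartition classes $X_G,Y_G$; $\bigcup_{x\in X_G}L(x)\subseteq X^*$ and $\bigcup_{y\in Y_G}L(y)\subseteq Y^*$; and each $L(x)$ is an incomparable set, i.e. for distinct $a,b\in L(x)$, $N(a)\not\subseteq N(b)$ and $N(b)\not\subseteq N(a)$ in $H^*$. -}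

module Defs where

open import Data.Nat using (ℕ)
open import Data.Fin using (Fin)
open import Data.Bool using (Bool; true; false; _∨_)
open import Data.Sum using (_⊎_; inj₁; inj₂)
open import Data.Product using (Σ; _×_; ∃)
open import Relation.Binary.PropositionalEquality using (_≡_; _≢_)
open import Relation.Nullary using (¬_)

-- A finite graph (loops allowed) on vertex set Fin n, given by a symmetric
-- Boolean adjacency relation; adj v v ≡ true means a loop at v.
record Graph : Set where
  field
    size : ℕ
    adj  : Fin size → Fin size → Bool
    adj-sym : ∀ u v → adj u v ≡ adj v u
open Graph public

-- Vertex set of H* : inj₁ v = v' (class X*), inj₂ v = v'' (class Y*).
StarV : Graph → Set
StarV H = Fin (size H) ⊎ Fin (size H)

starAdj : (H : Graph) → StarV H → StarV H → Bool
starAdj H (inj₁ u) (inj₂ v) = adj H u v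
starAdj H (inj₂ v) (inj₁ u) = adj H u v
starAdj H (inj₁ _) (inj₁ _) = false
starAdj H (inj₂ _) (inj₂ _) = false

ListHom : {A B : Set} → (A → A → Bool) → (B → B → Bool) → (A → B → Bool) → Set
ListHom {A} {B} EG EH L =
  Σ (A → B) λ h →
    (∀ x y → EG x y ≡ true → EH (h x) (h y) ≡ true) ×
    (∀ x → L x (h x) ≡ true)

data Reach (G : Graph) : Fin (size G) → Fin (size G) → Set where
  here : ∀ {x} → Reach G x x
  step : ∀ {x y z} → adj G x y ≡ true → Reach G y z → Reach G x z

Connected : Graph → Set
Connected G = ∀ x y → Reach G x y

NbhdSub : (H : Graph) → StarV H → StarV H → Set
NbhdSub H a b = ∀ c → starAdj H a c ≡ true → starAdj H b c ≡ true

Incomparable : (H : Graph) → (StarV H → Bool) → Set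
Incomparable H S = ∀ a b → S a ≡ true → S b ≡ true → a ≢ b →
  ¬ NbhdSub H a b × ¬ NbhdSub H b a

IsX* : {H : Graph} → StarV H → Set
IsX* (inj₁ _) = Data.Unit.⊤ where import Data.Unit
IsX* (inj₂ _) = Data.Empty.⊥ where import Data.Empty

IsY* : {H : Graph} → StarV H → Set
IsY* (inj₁ _) = Data.Empty.⊥ where import Data.Empty
IsY* (inj₂ _) = Data.Unit.⊤ where import Data.Unit

-- Consistent instance (G, L) of LHom(H*).  The bipartition (X_G, Y_G) of G is
-- given by side : V(G) → Bool with X_G = side⁻¹(false), Y_G = side⁻¹(true).
Consistent : (H G : Graph) → (Fin (size G) → StarV H → Bool) → Set
Consistent H G L =
  Connected G ×
  Σ (Fin (size G) → Bool) (λ side →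
     (∀ x y → adj G x y ≡ true → side x ≢ side y) ×
     (∀ x a → side x ≡ false → L x a ≡ true → IsX* {H} a) ×
     (∀ y a → side y ≡ true  → L y a ≡ true → IsY* {H} a)) ×
  (∀ x → Incomparable H (L x))

L′ : (H G : Graph) → (Fin (size G) → StarV H → Bool) → Fin (size G) → Fin (size H) → Bool
L′ H G L x u = L x (inj₁ u) ∨ L x (inj₂ u)

module Submission where

open import Defs
open import Data.Fin using (Fin)
open import Data.Bool using (Bool; true; false; _∨_)
open import Data.Bool.Properties using (∨-sel; ∨-zeroʳ)
open import Data.Sum using (inj₁; inj₂)
open import Data.Product using (_,_)
open import Data.Empty using (⊥-elim)
open import Relation.Binary.PropositionalEquality using (_≡_; _≢_; refl; sym; trans)
open import Function.Bundles using (_⇔_; mk⇔)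

-- Forgetting the primes turns a homomorphism to H* into one to H with lists L′.
-- Conversely, sending x to the copy of its image on the side of H* matching the
-- bipartition class of x gives a homomorphism to H*: edges of G join opposite
-- classes, and only that copy can lie in L(x).

module _ {H : Graph} where

  base : StarV H → Fin (size H)
  base (inj₁ u) = u
  base (inj₂ u) = u

  starAdj⇒adj : ∀ a b → starAdj H a b ≡ true → adj H (base a) (base b) ≡ true
  starAdj⇒adj (inj₁ u) (inj₂ v) e = e
  starAdj⇒adj (inj₂ v) (inj₁ u) e = trans (adj-sym H v u) e

  ∈⇒base-∈-either-copy : (S : StarV H → Bool) → ∀ a → S a ≡ true →
    S (inj₁ (base a)) ∨ S (inj₂ (base a)) ≡ true
  ∈⇒base-∈-either-copy S (inj₁ u) e rewrite e = refl
  ∈⇒base-∈-either-copy S (inj₂ u) e rewrite e = ∨-zeroʳ _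

  copy : Bool → Fin (size H) → StarV H
  copy false = inj₁
  copy true  = inj₂

  adj⇒starAdj-copy : ∀ s t u v → s ≢ t → adj H u v ≡ true →
    starAdj H (copy s u) (copy t v) ≡ true
  adj⇒starAdj-copy false false u v s≢t e = ⊥-elim (s≢t refl)
  adj⇒starAdj-copy false true  u v s≢t e = e
  adj⇒starAdj-copy true  false u v s≢t e = trans (adj-sym H v u) e
  adj⇒starAdj-copy true  true  u v s≢t e = ⊥-elim (s≢t refl)

  OnSide : Bool → StarV H → Set
  OnSide false = IsX* {H}
  OnSide true  = IsY* {H}

  either-copy-∈⇒copy-∈ : (S : StarV H → Bool) (s : Bool) →
    (∀ a → S a ≡ true → OnSide s a) →
    ∀ u → S (inj₁ u) ∨ S (inj₂ u) ≡ true → S (copy s u) ≡ true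
  either-copy-∈⇒copy-∈ S s onSide u p with ∨-sel (S (inj₁ u)) (S (inj₂ u)) | s
  ... | inj₁ eq | false = trans (sym eq) p
  ... | inj₁ eq | true  = ⊥-elim (onSide (inj₁ u) (trans (sym eq) p))
  ... | inj₂ eq | false = ⊥-elim (onSide (inj₂ u) (trans (sym eq) p))
  ... | inj₂ eq | true  = trans (sym eq) p

module _ (H G : Graph) (L : Fin (size G) → StarV H → Bool) where

  forgetPrimes : ListHom (adj G) (starAdj H) L → ListHom (adj G) (adj H) (L′ H G L)
  forgetPrimes (h , h-edge , h-list) =
    (λ x → base (h x)) ,
    (λ x y e → starAdj⇒adj (h x) (h y) (h-edge x y e)) ,
    (λ x → ∈⇒base-∈-either-copy (L x) (h x) (h-list x))

  liftAlongSides : (side : Fin (size G) → Bool) →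
    (∀ x y → adj G x y ≡ true → side x ≢ side y) →
    (∀ x a → L x a ≡ true → OnSide (side x) a) →
    ListHom (adj G) (adj H) (L′ H G L) → ListHom (adj G) (starAdj H) L
  liftAlongSides side proper onSide (f , f-edge , f-list) =
    (λ x → copy (side x) (f x)) ,
    (λ x y e → adj⇒starAdj-copy (side x) (side y) (f x) (f y) (proper x y e) (f-edge x y e)) ,
    (λ x → either-copy-∈⇒copy-∈ (L x) (side x) (onSide x) (f x) (f-list x))

  listsOnSide : (side : Fin (size G) → Bool) →
    (∀ x a → side x ≡ false → L x a ≡ true → IsX* {H} a) →
    (∀ y a → side y ≡ true  → L y a ≡ true → IsY* {H} a) →
    ∀ x a → L x a ≡ true → OnSide (side x) a
  listsOnSide side inX inY x a a∈ with side x in eq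
  ... | false = inX x a eq a∈
  ... | true  = inY x a eq a∈

mainTheorem13 : (H G : Graph) (L : Fin (size G) → StarV H → Bool) →
    Consistent H G L →
    ListHom (adj G) (starAdj H) L ⇔ ListHom (adj G) (adj H) (L′ H G L)
mainTheorem13 H G L (_ , (side , proper , inX , inY) , _) =
  mk⇔ (forgetPrimes H G L)
      (liftAlongSides H G L side proper (listsOnSide H G L side inX inY))
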